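{- Let $(a_n)$ be an Euler–Gauss sequence such that $\gcd(a_n,n)=1$ for all $n\ge1$. Then $(a_n)$ is a Gauss sequence, i.e. $\sum_{d\mid n}\mu(d)a_{n/d}\equiv0\pmod n$ for all $n\ge1$.
   Context: $\mu$ is the Möbius function. An integer sequence $(a_n)$ is Euler–Gauss if for all $n\ge1$, $\prod_{d\mid n,\ \mu(d)=1} a_{n/d}\equiv \prod_{d\mid n,\ \mu(d)=-1} a_{n/d}\pmod n$ (empty products equal $1$). -}

module Defs where

open import Data.Nat as ℕ using (ℕ; zero; suc; _≤_; _<_)
open import Data.Nat.Divisibility using (_∣_; _∣?_)
open import Data.Nat.Primality using (prime?)
open import Data.Nat.DivMod using (_/_)
open import Data.Integer as ℤ using (ℤ; +_; -_; _-_)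
open import Data.Integer.Divisibility renaming (_∣_ to _∣ℤ_)
open import Data.List using (List; []; _∷_; filter; map; length; foldr; sum; upTo; applyUpTo)
open import Data.List.Relation.Unary.All using (All)
open import Relation.Nullary using (¬_; Dec; yes; no)
open import Relation.Nullary.Decidable using (⌊_⌋; ¬?)
open import Data.Bool using (Bool; true; false; if_then_else_)

divisors : ℕ → List ℕ
divisors n = filter (λ d → d ∣? n) (applyUpTo suc n)

ω : ℕ → ℕ
ω n = length (filter (λ p → p ∣? n) (filter prime? (applyUpTo suc n)))

squarefree? : ℕ → Bool
squarefree? n = ⌊ Data.List.Relation.Unary.All.all? (λ k → ¬? ((k ℕ.* k) ∣? n))
                      (applyUpTo (λ i → suc (suc i)) n) ⌋

μ : ℕ → ℤ
μ n = if squarefree? n then (-1ℤ) ℤ.^ ω n else + 0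
  where -1ℤ = - (+ 1)

_≡_[mod_] : ℤ → ℤ → ℕ → Set
x ≡ y [mod n ] = (+ n) ∣ℤ (x - y)

prodμ : (ℕ → ℤ) → ℤ → ℕ → ℤ
prodμ a s n = foldr ℤ._*_ (+ 1)
  (map (λ d → a (n / suc (ℕ.pred d)))
       (filter (λ d → μ d ℤ.≟ s) (divisors n)))

EulerGauss : (ℕ → ℤ) → Set
EulerGauss a = ∀ n → 1 ≤ n → prodμ a (+ 1) n ≡ prodμ a (- (+ 1)) n [mod n ]

Gauss : (ℕ → ℤ) → Set
Gauss a = ∀ n → 1 ≤ n →
  foldr ℤ._+_ (+ 0) (map (λ d → μ d ℤ.* a (n / suc (ℕ.pred d))) (divisors n))
    ≡ + 0 [mod n ]

{-# OPTIONS --safe #-}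

-- Fix a prime p and write N = p^(j+1) m with p ∤ m.  Divisors of N divisible by p² have μ = 0; the others
-- come in pairs d, p d with d ∣ m and μ(p d) = -μ(d), and for c = m / d they pick out a(p^(j+1) c) and a(p^j c).
-- By strong induction on m, a(p^(j+1) m) ≡ a(p^j m) (mod p^(j+1)): in the Euler–Gauss congruence for N every
-- pair with d > 1 contributes the same factor to both sides modulo p^(j+1), that factor is prime to p because
-- gcd(a_k, k) = 1, and cancelling it leaves the pair d = 1, i.e. a(N) ≡ a(N / p).  The same pairing turns the
-- Gauss sum for N into a sum of terms μ(d) (a(p^(j+1) c) - a(p^j c)) ≡ 0, and divisibility by every prime
-- power dividing n gives divisibility by n.
module Submission where

open import Defs
open import Data.Nat using (ℕ; _≤_)
open import Data.Integer using (ℤ; ∣_∣)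
open import Data.Nat.GCD using (gcd; gcd-greatest)
open import Relation.Binary.PropositionalEquality using (_≡_)

open import Algebra.Bundles using (CommutativeMonoid)
import Algebra.Properties.CommutativeSemigroup
open import Algebra.Structures using (IsCommutativeMonoid)
open import Data.Bool using (true; false; if_then_else_)
open import Data.Integer as ℤ using (+_; -_; 0ℤ; 1ℤ)
import Data.Integer.Properties as ℤ
import Data.Integer.Divisibility.Signed as ℤ
open import Data.Integer.Tactic.RingSolver using (solve-∀)
open import Data.Nat.Tactic.RingSolver using () renaming (solve-∀ to ℕ-solve-∀)
open import Data.List using (List; []; _∷_; _++_; map; filter; foldr; applyUpTo)
open import Data.List.Relation.Binary.Permutation.Propositional using (_↭_; ↭⇒↭ₛ)
import Data.List.Relation.Binary.Permutation.Propositional.Properties as ↭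
open import Data.List.Relation.Binary.Permutation.Setoid.Properties using (foldr-commMonoid)
open import Data.List.Relation.Unary.All as All using (All; []; _∷_)
open import Data.List.Relation.Unary.AllPairs using (_∷_)
open import Data.List.Relation.Unary.Any using (here; there)
open import Data.List.Membership.Propositional using (_∈_)
open import Data.List.Membership.Propositional.Properties
  using (∈-filter⁺; ∈-filter⁻; ∈-applyUpTo⁺; ∈-applyUpTo⁻; ∈-map⁺; ∈-map⁻; ∈-++⁺ˡ; ∈-++⁺ʳ; ∈-++⁻)
open import Data.List.Membership.Propositional.Properties.WithK using (unique∧set⇒bag)
open import Data.List.Properties using (filter-accept; map-++; map-∘; map-cong)
open import Data.List.Relation.Binary.BagAndSetEquality using (∼bag⇒↭)
open import Data.List.Relation.Binary.Disjoint.Propositional using (Disjoint)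
open import Data.List.Relation.Unary.Unique.Propositional using (Unique)
import Data.List.Relation.Unary.Unique.Propositional.Properties as Unique
open import Data.Nat as ℕ using (zero; suc; _*_; _^_; _<_; z≤n; s≤s; NonZero; >-nonZero)
import Data.Nat.Properties as ℕ
open import Data.Nat.Coprimality using (Coprime; coprime-divisor)
import Data.Nat.Coprimality as Coprime
open import Data.Nat.Divisibility
  using (_∣_; _∤_; divides; _∣?_; ∣-trans; ∣1⇒≡1; _∣0; 0∣⇒≡0; 1∣_; ∣⇒≤; m∣m*n; ∣n⇒∣m*n; *-monoˡ-∣; *-monoʳ-∣; *-pres-∣; *-cancelˡ-∣; quotient≢0; quotient-∣)
open import Data.Nat.DivMod using (_/_; /-congˡ; /-congʳ; m*n/n≡m; n/1≡n)
open import Data.Nat.Induction using (<-rec)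
open import Data.Nat.Primality using (Prime; prime?; ¬prime[1]; euclidsLemma; prime⇒irreducible; prime⇒nonZero; prime⇒nonTrivial)
open import Data.Nat.Primality.Factorisation using (factorise)
open import Data.Product using (∃-syntax; ∃₂; _×_; _,_; proj₁; proj₂)
open import Data.Sum using (_⊎_; inj₁; inj₂; [_,_]′)
open import Function using (_∘_; it; case_of_; _⇔_; Equivalence; mk⇔)
import Function.Properties.Equivalence as ⇔
open import Relation.Binary.Bundles using (Setoid)
import Relation.Binary.Reasoning.Setoid as ≈-Reasoning
open import Level using (0ℓ)
open import Relation.Binary.PropositionalEquality as ≡ using (_≢_; refl; sym; trans; cong; cong₂; subst; subst₂)
open import Relation.Nullary using (¬_; ¬?; Dec; yes; no; does; contradiction)
open import Relation.Nullary.Decidable using (isYes; isYes≗does; does-⇔; dec-true; dec-false)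

private
  variable
    c d k m n o p q r : ℕ
    s x y z w : ℤ

-- Primes, coprimality and prime powers

prime⇒2≤ : Prime p → 2 ≤ p
prime⇒2≤ {p} p-prime = ℕ.nonTrivial⇒n>1 p {{prime⇒nonTrivial p-prime}}

prime⇒∤1 : Prime p → p ∤ 1
prime⇒∤1 p-prime p∣1 = ¬prime[1] (subst Prime (∣1⇒≡1 p∣1) p-prime)

prime∤⇒coprime : Prime p → p ∤ n → Coprime p n
prime∤⇒coprime p-prime p∤n (d∣p , d∣n) with prime⇒irreducible p-prime d∣p
... | inj₁ d≡1 = d≡1
... | inj₂ refl = contradiction d∣n p∤n

coprime-*ʳ : Coprime m n → Coprime m k → Coprime m (n * k)
coprime-*ʳ m⊥n m⊥k (d∣m , d∣n*k) = m⊥k (d∣m , coprime-divisor d⊥n d∣n*k)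
  where
  d⊥n : Coprime _ _
  d⊥n (e∣d , e∣n) = m⊥n (∣-trans e∣d d∣m , e∣n)

coprime-^ʳ : Coprime m n → ∀ k → Coprime m (n ^ k)
coprime-^ʳ m⊥n zero    = Coprime.sym (Coprime.1-coprimeTo _)
coprime-^ʳ m⊥n (suc k) = coprime-*ʳ m⊥n (coprime-^ʳ m⊥n k)

prime∤⇒coprime-^ : Prime p → p ∤ n → ∀ k → Coprime n (p ^ k)
prime∤⇒coprime-^ p-prime p∤n = coprime-^ʳ (Coprime.sym (prime∤⇒coprime p-prime p∤n))

prime^∣*∤⇒∣ : Prime p → p ∤ n → ∀ k → p ^ k ∣ m * n → p ^ k ∣ m
prime^∣*∤⇒∣ {p} {n} {m} p-prime p∤n k p^k∣m*n =
  coprime-divisor (Coprime.sym (prime∤⇒coprime-^ p-prime p∤n k)) (subst (p ^ k ∣_) (ℕ.*-comm m n) p^k∣m*n)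

∤⇒nonZero : d ∤ m → NonZero m
∤⇒nonZero {m = zero}  d∤0 = contradiction (_ ∣0) d∤0
∤⇒nonZero {m = suc _} _   = _

1<prime^suc : Prime p → ∀ k → 1 < p ^ suc k
1<prime^suc {p} p-prime k = ℕ.<-≤-trans (prime⇒2≤ p-prime) (ℕ.m≤m*n p (p ^ k) {{ℕ.m^n≢0 p k}})
  where instance _ = prime⇒nonZero p-prime

coprime-∣⇒*∣ : Coprime m n → m ∣ o → n ∣ o → m * n ∣ o
coprime-∣⇒*∣ {m} {n} m⊥n m∣t*n (divides t refl) =
  *-monoˡ-∣ n (coprime-divisor m⊥n (subst (m ∣_) (ℕ.*-comm t n) m∣t*n))

prime-divisor : ∀ n → 2 ≤ n → ∃[ p ] Prime p × p ∣ n
prime-divisor n@(suc _) 2≤n with factorise n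
... | record { factors = [] ; isFactorisation = n≡1 } = contradiction n≡1 (ℕ.>⇒≢ 2≤n)
... | record { factors = p ∷ _ ; isFactorisation = n≡p*_ ; factorsPrime = p-prime ∷ _ } =
  p , p-prime , subst (p ∣_) (sym n≡p*_) (m∣m*n _)

p-adic-split : Prime p → ∀ n → .{{NonZero n}} → ∃₂ λ k m → p ∤ m × n ≡ p ^ k * m
p-adic-split {p} p-prime = <-rec _ split
  where
  split : ∀ n → (∀ {n′} → n′ < n → .{{NonZero n′}} → ∃₂ λ k m → p ∤ m × n′ ≡ p ^ k * m) →
          .{{NonZero n}} → ∃₂ λ k m → p ∤ m × n ≡ p ^ k * m
  split n rec with p ∣? n
  ... | no p∤n = 0 , n , p∤n , sym (ℕ.*-identityˡ n)
  ... | yes (divides n′ refl) with rec (ℕ.m<m*n n′ p (prime⇒2≤ p-prime)) {{n′≢0}}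
    where instance n′≢0 = ℕ.m*n≢0⇒m≢0 n′
  ...   | k , m , p∤m , n′≡p^k*m =
    suc k , m , p∤m , trans (cong (_* p) n′≡p^k*m) (trans (ℕ.*-comm _ p) (sym (ℕ.*-assoc p (p ^ k) m)))

prime-powers-∣⇒∣ : ∀ n → .{{NonZero n}} → (∀ p k → Prime p → p ^ k ∣ n → p ^ k ∣ o) → n ∣ o
prime-powers-∣⇒∣ {o} = <-rec _ divides-o
  where
  divides-o : ∀ n → (∀ {n′} → n′ < n → .{{NonZero n′}} → (∀ p k → Prime p → p ^ k ∣ n′ → p ^ k ∣ o) → n′ ∣ o) →
              .{{NonZero n}} → (∀ p k → Prime p → p ^ k ∣ n → p ^ k ∣ o) → n ∣ o
  divides-o 1 _ _ = 1∣ o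
  divides-o n@(suc (suc _)) rec local with prime-divisor n (s≤s (s≤s z≤n))
  ... | p , p-prime , p∣n with p-adic-split p-prime n
  ...   | zero  , m , p∤m , n≡m = contradiction (subst (p ∣_) (trans n≡m (ℕ.*-identityˡ m)) p∣n) p∤m
  ...   | suc k , m , p∤m , n≡p^k*m = subst (_∣ o) (sym n≡p^k*m)
    (coprime-∣⇒*∣ (Coprime.sym (prime∤⇒coprime-^ p-prime p∤m (suc k)))
      (local p (suc k) p-prime (subst (p ^ suc k ∣_) (sym n≡p^k*m) (m∣m*n m)))
      (rec m<n (λ q j q-prime q^j∣m → local q j q-prime (∣-trans q^j∣m m∣n))))
    where
    instance _ = ∤⇒nonZero p∤m
    m∣n : m ∣ n
    m∣n = divides (p ^ suc k) n≡p^k*m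
    m<n : m < n
    m<n = subst₂ _<_ (ℕ.*-identityˡ m) (sym n≡p^k*m) (ℕ.*-monoˡ-< m (1<prime^suc p-prime k))

-- Congruences of integers

-- The congruence `_≡_[mod_]` of Defs, as a record so that both sides can be inferred from a proof.
infix 4 _≡_⟨mod_⟩
record _≡_⟨mod_⟩ (x y : ℤ) (q : ℕ) : Set where
  constructor mod
  field divides-difference : + q ℤ.∣ x ℤ.- y

≡[mod]⇒≡⟨mod⟩ : x ≡ y [mod q ] → x ≡ y ⟨mod q ⟩
≡[mod]⇒≡⟨mod⟩ q∣x-y = mod (ℤ.∣ᵤ⇒∣ q∣x-y)

≡⟨mod⟩⇒≡[mod] : x ≡ y ⟨mod q ⟩ → x ≡ y [mod q ]
≡⟨mod⟩⇒≡[mod] (mod q∣x-y) = ℤ.∣⇒∣ᵤ q∣x-y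

module _ {q : ℕ} where

  private
    mod-via : z ≡ x ℤ.- y → + q ℤ.∣ z → x ≡ y ⟨mod q ⟩
    mod-via z≡x-y q∣z = mod (subst (+ q ℤ.∣_) z≡x-y q∣z)

  ≡-mod-refl : x ≡ x ⟨mod q ⟩
  ≡-mod-refl {x} = mod-via (sym (ℤ.+-inverseʳ x)) (ℤ.∣ᵤ⇒∣ (q ∣0))

  ≡-mod-reflexive : x ≡ y → x ≡ y ⟨mod q ⟩
  ≡-mod-reflexive refl = ≡-mod-refl

  ≡-mod-sym : x ≡ y ⟨mod q ⟩ → y ≡ x ⟨mod q ⟩
  ≡-mod-sym {x} {y} (mod q∣x-y) = mod-via (identity x y) (ℤ.∣m⇒∣-m q∣x-y)
    where
    identity : ∀ x y → - (x ℤ.- y) ≡ y ℤ.- x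
    identity = solve-∀

  ≡-mod-trans : x ≡ y ⟨mod q ⟩ → y ≡ z ⟨mod q ⟩ → x ≡ z ⟨mod q ⟩
  ≡-mod-trans {x} {y} {z} (mod q∣x-y) (mod q∣y-z) = mod-via (identity x y z) (ℤ.∣m∣n⇒∣m+n q∣x-y q∣y-z)
    where
    identity : ∀ x y z → (x ℤ.- y) ℤ.+ (y ℤ.- z) ≡ x ℤ.- z
    identity = solve-∀

  ≡-mod-+-cong : x ≡ y ⟨mod q ⟩ → z ≡ w ⟨mod q ⟩ → x ℤ.+ z ≡ y ℤ.+ w ⟨mod q ⟩
  ≡-mod-+-cong {x} {y} {z} {w} (mod q∣x-y) (mod q∣z-w) =
    mod-via (identity x y z w) (ℤ.∣m∣n⇒∣m+n q∣x-y q∣z-w)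
    where
    identity : ∀ x y z w → (x ℤ.- y) ℤ.+ (z ℤ.- w) ≡ (x ℤ.+ z) ℤ.- (y ℤ.+ w)
    identity = solve-∀

  ≡-mod-*-cong : x ≡ y ⟨mod q ⟩ → z ≡ w ⟨mod q ⟩ → x ℤ.* z ≡ y ℤ.* w ⟨mod q ⟩
  ≡-mod-*-cong {x} {y} {z} {w} (mod q∣x-y) (mod q∣z-w) =
    mod-via (identity x y z w) (ℤ.∣m∣n⇒∣m+n (ℤ.∣m⇒∣m*n z q∣x-y) (ℤ.∣n⇒∣m*n y q∣z-w))
    where
    identity : ∀ x y z w → (x ℤ.- y) ℤ.* z ℤ.+ y ℤ.* (z ℤ.- w) ≡ x ℤ.* z ℤ.- y ℤ.* w
    identity = solve-∀

≡-mod-setoid : ℕ → Setoid 0ℓ 0ℓ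
≡-mod-setoid q = record
  { Carrier       = ℤ
  ; _≈_           = _≡_⟨mod q ⟩
  ; isEquivalence = record { refl = ≡-mod-refl ; sym = ≡-mod-sym ; trans = ≡-mod-trans }
  }

≡-mod-∣ : q ∣ r → x ≡ y ⟨mod r ⟩ → x ≡ y ⟨mod q ⟩
≡-mod-∣ q∣r (mod r∣x-y) = mod (ℤ.∣-trans (ℤ.∣ᵤ⇒∣ q∣r) r∣x-y)

≡-mod-*-cancelʳ : Prime p → p ∤ ∣ z ∣ → x ℤ.* z ≡ y ℤ.* z ⟨mod p ^ k ⟩ → x ≡ y ⟨mod p ^ k ⟩
≡-mod-*-cancelʳ {p} {z} {x} {y} {k} p-prime p∤z (mod p^k∣xz-yz) =
  mod (ℤ.∣ᵤ⇒∣ (prime^∣*∤⇒∣ p-prime p∤z k (subst (p ^ k ∣_) ∣xz-yz∣≡ (ℤ.∣⇒∣ᵤ p^k∣xz-yz))))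
  where
  identity : ∀ x y z → x ℤ.* z ℤ.- y ℤ.* z ≡ (x ℤ.- y) ℤ.* z
  identity = solve-∀
  ∣xz-yz∣≡ : ∣ x ℤ.* z ℤ.- y ℤ.* z ∣ ≡ ∣ x ℤ.- y ∣ ℕ.* ∣ z ∣
  ∣xz-yz∣≡ = trans (cong ∣_∣ (identity x y z)) (ℤ.abs-* (x ℤ.- y) z)

-- Folds over a commutative monoid

module CommutativeMonoidFold {A : Set} {_∙_ : A → A → A} {ε : A}
                             (isCommutativeMonoid : IsCommutativeMonoid _≡_ _∙_ ε) where

  open IsCommutativeMonoid isCommutativeMonoid using (assoc; identityˡ)
  private
    commutativeMonoid : CommutativeMonoid 0ℓ 0ℓ
    commutativeMonoid = record { isCommutativeMonoid = isCommutativeMonoid }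

  open Algebra.Properties.CommutativeSemigroup (CommutativeMonoid.commutativeSemigroup commutativeMonoid)
    using (interchange)

  fold : List A → A
  fold = foldr _∙_ ε

  fold-↭ : {xs ys : List A} → xs ↭ ys → fold xs ≡ fold ys
  fold-↭ xs↭ys = foldr-commMonoid (≡.setoid A) isCommutativeMonoid (↭⇒↭ₛ xs↭ys)

  fold-++ : ∀ xs ys → fold (xs ++ ys) ≡ fold xs ∙ fold ys
  fold-++ []       ys = sym (identityˡ (fold ys))
  fold-++ (x ∷ xs) ys = trans (cong (x ∙_) (fold-++ xs ys)) (sym (assoc x (fold xs) (fold ys)))

  fold-map-∙ : ∀ {B : Set} (f g : B → A) xs →
               fold (map (λ b → f b ∙ g b) xs) ≡ fold (map f xs) ∙ fold (map g xs)
  fold-map-∙ f g []       = sym (identityˡ ε)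
  fold-map-∙ f g (b ∷ bs) =
    trans (cong ((f b ∙ g b) ∙_) (fold-map-∙ f g bs)) (interchange (f b) (g b) _ _)

  fold-map-ε : ∀ {B : Set} {f : B → A} {xs} → All (λ b → f b ≡ ε) xs → fold (map f xs) ≡ ε
  fold-map-ε []             = refl
  fold-map-ε (fb≡ε ∷ fbs≡ε) = trans (cong₂ _∙_ fb≡ε (fold-map-ε fbs≡ε)) (identityˡ ε)

  fold-map-closed : ∀ {B : Set} {f : B → A} {xs} (P : A → Set) → P ε → (∀ {x y} → P x → P y → P (x ∙ y)) →
                    All (P ∘ f) xs → P (fold (map f xs))
  fold-map-closed P Pε ∙-closed []           = Pε
  fold-map-closed P Pε ∙-closed (Pfb ∷ Pfbs) = ∙-closed Pfb (fold-map-closed P Pε ∙-closed Pfbs)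

  fold-map-cong : ∀ {B : Set} {f g : B → A} {xs} (_~_ : A → A → Set) → ε ~ ε →
                  (∀ {x y z w} → x ~ y → z ~ w → (x ∙ z) ~ (y ∙ w)) →
                  All (λ b → f b ~ g b) xs → fold (map f xs) ~ fold (map g xs)
  fold-map-cong _~_ ε~ε ∙-cong []             = ε~ε
  fold-map-cong _~_ ε~ε ∙-cong (fb~gb ∷ fbs~gbs) = ∙-cong fb~gb (fold-map-cong _~_ ε~ε ∙-cong fbs~gbs)

  infix 8 _when_
  _when_ : ∀ {P : Set} → A → Dec P → A
  x when P? = if does P? then x else ε

  when-true : ∀ {P : Set} {x} (P? : Dec P) → P → x when P? ≡ x
  when-true {x = x} P? p = cong (if_then x else ε) (dec-true P? p)

  when-false : ∀ {P : Set} {x} (P? : Dec P) → ¬ P → x when P? ≡ ε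
  when-false {x = x} P? ¬p = cong (if_then x else ε) (dec-false P? ¬p)

  when-⇔ : ∀ {P Q : Set} {x} → P ⇔ Q → (P? : Dec P) (Q? : Dec Q) → x when P? ≡ x when Q?
  when-⇔ {x = x} P⇔Q P? Q? = cong (if_then x else ε) (does-⇔ P⇔Q P? Q?)

  fold-filter : ∀ {B : Set} {P : B → Set} (P? : ∀ b → Dec (P b)) (f : B → A) xs →
                fold (map f (filter P? xs)) ≡ fold (map (λ b → f b when P? b) xs)
  fold-filter P? f []       = refl
  fold-filter P? f (b ∷ bs) with does (P? b)
  ... | true  = cong (f b ∙_) (fold-filter P? f bs)
  ... | false = trans (fold-filter P? f bs) (sym (identityˡ _))

∣⇒nonZero : .{{NonZero n}} → d ∣ n → NonZero d
∣⇒nonZero {d = zero}  0∣n = contradiction (0∣⇒≡0 0∣n) (ℕ.≢-nonZero⁻¹ _)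
∣⇒nonZero {d = suc _} _   = _

∣⇒∈upTo : .{{NonZero n}} → d ∣ n → d ∈ applyUpTo suc n
∣⇒∈upTo {d = zero}  0∣n = contradiction (0∣⇒≡0 0∣n) (ℕ.≢-nonZero⁻¹ _)
∣⇒∈upTo {d = suc _} d∣n = ∈-applyUpTo⁺ suc (∣⇒≤ d∣n)

applyUpTo-suc-unique : ∀ n → Unique (applyUpTo suc n)
applyUpTo-suc-unique n = Unique.applyUpTo⁺₁ suc n (λ i<j _ → ℕ.<⇒≢ i<j ∘ ℕ.suc-injective)

∈-divisors⁺ : .{{NonZero n}} → d ∣ n → d ∈ divisors n
∈-divisors⁺ {n} d∣n = ∈-filter⁺ (_∣? n) (∣⇒∈upTo d∣n) d∣n

∈-divisors⁻ : ∀ n → d ∈ divisors n → d ∣ n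
∈-divisors⁻ n d∈ = proj₂ (∈-filter⁻ (_∣? n) {xs = applyUpTo suc n} d∈)

divisors-unique : ∀ n → Unique (divisors n)
divisors-unique n = Unique.filter⁺ (_∣? n) (applyUpTo-suc-unique n)

divisors>1 : ℕ → List ℕ
divisors>1 m = filter (_∣? m) (applyUpTo (suc ∘ suc) (ℕ.pred m))

divisors≡1∷divisors>1 : ∀ m → .{{NonZero m}} → divisors m ≡ 1 ∷ divisors>1 m
divisors≡1∷divisors>1 (suc m) = filter-accept (_∣? suc m) (1∣ suc m)

∈-divisors>1⁻ : ∀ m → d ∈ divisors>1 m → d ∣ m × 2 ≤ d
∈-divisors>1⁻ m d∈ with ∈-filter⁻ (_∣? m) {xs = applyUpTo (suc ∘ suc) (ℕ.pred m)} d∈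
... | d∈upTo , d∣m with ∈-applyUpTo⁻ (suc ∘ suc) d∈upTo
...   | _ , _ , refl = d∣m , s≤s (s≤s z≤n)

-- The Möbius function

SquareFree : ℕ → Set
SquareFree n = ∀ {k} → 2 ≤ k → k * k ∤ n

All-squares∤⇔SquareFree : ∀ n → .{{NonZero n}} →
                          All (λ k → k * k ∤ n) (applyUpTo (suc ∘ suc) n) ⇔ SquareFree n
All-squares∤⇔SquareFree n = mk⇔ to from
  where
  to : All (λ k → k * k ∤ n) (applyUpTo (suc ∘ suc) n) → SquareFree n
  to all {k@(suc (suc _))} (s≤s (s≤s _)) k²∣n =
    All.lookup all (∈-applyUpTo⁺ (suc ∘ suc) (ℕ.m+n≤o⇒n≤o 1 (ℕ.≤-trans (ℕ.m≤m*n k k) (∣⇒≤ k²∣n)))) k²∣n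
  from : SquareFree n → All (λ k → k * k ∤ n) (applyUpTo (suc ∘ suc) n)
  from squarefree = All.tabulate λ k∈ → case ∈-applyUpTo⁻ (suc ∘ suc) k∈ of λ where
    (_ , _ , refl) → squarefree (s≤s (s≤s z≤n))

-- `squarefree? n` is `isYes (squares∤? n)` by definition.
squares∤? : ∀ n → Dec (All (λ k → k * k ∤ n) (applyUpTo (suc ∘ suc) n))
squares∤? n = All.all? (λ k → ¬? (k * k ∣? n)) (applyUpTo (suc ∘ suc) n)

SquareFree-*-prime : Prime p → p ∤ d → SquareFree (p * d) ⇔ SquareFree d
SquareFree-*-prime {p} {d} p-prime p∤d = mk⇔ to from
  where
  to : SquareFree (p * d) → SquareFree d
  to squarefree 2≤k k²∣d = squarefree 2≤k (∣n⇒∣m*n p k²∣d)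
  from : SquareFree d → SquareFree (p * d)
  from squarefree {k} 2≤k k²∣pd with p ∣? k
  ... | yes p∣k = p∤d (*-cancelˡ-∣ p {{prime⇒nonZero p-prime}} (∣-trans (*-pres-∣ p∣k p∣k) k²∣pd))
  ... | no p∤k  = squarefree 2≤k (coprime-divisor (Coprime.sym (prime∤⇒coprime p-prime p∤k²)) k²∣pd)
    where
    p∤k² : p ∤ k * k
    p∤k² p∣k² = [ p∤k , p∤k ]′ (euclidsLemma k k p-prime p∣k²)

squarefree?-*-prime : Prime p → p ∤ d → .{{NonZero d}} → squarefree? (p * d) ≡ squarefree? d
squarefree?-*-prime {p} {d} p-prime p∤d = begin
  isYes (squares∤? (p * d)) ≡⟨ isYes≗does (squares∤? (p * d)) ⟩
  does (squares∤? (p * d))  ≡⟨ does-⇔ squares∤[p*d]⇔squares∤[d] (squares∤? (p * d)) (squares∤? d) ⟩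
  does (squares∤? d)        ≡⟨ isYes≗does (squares∤? d) ⟨
  isYes (squares∤? d)       ∎
  where
  open ≡.≡-Reasoning
  squares∤[p*d]⇔squares∤[d] = ⇔.trans (All-squares∤⇔SquareFree (p * d) {{ℕ.m*n≢0 p d {{prime⇒nonZero p-prime}}}})
    (⇔.trans (SquareFree-*-prime p-prime p∤d) (⇔.sym (All-squares∤⇔SquareFree d)))

-- `ω n` is `length (primeDivisors n)` by definition.
primeDivisors : ℕ → List ℕ
primeDivisors n = filter (_∣? n) (filter prime? (applyUpTo suc n))

∈-primeDivisors⁺ : .{{NonZero n}} → Prime q → q ∣ n → q ∈ primeDivisors n
∈-primeDivisors⁺ {n} q-prime q∣n = ∈-filter⁺ (_∣? n) (∈-filter⁺ prime? (∣⇒∈upTo q∣n) q-prime) q∣n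

∈-primeDivisors⁻ : ∀ n → q ∈ primeDivisors n → Prime q × q ∣ n
∈-primeDivisors⁻ n q∈ =
  let q∈primes , q∣n = ∈-filter⁻ (_∣? n) {xs = filter prime? (applyUpTo suc n)} q∈
  in proj₂ (∈-filter⁻ prime? {xs = applyUpTo suc n} q∈primes) , q∣n

primeDivisors-unique : ∀ n → Unique (primeDivisors n)
primeDivisors-unique n = Unique.filter⁺ (_∣? n) (Unique.filter⁺ prime? (applyUpTo-suc-unique n))

primeDivisors-*-prime : Prime p → p ∤ d → .{{NonZero d}} → primeDivisors (p * d) ↭ p ∷ primeDivisors d
primeDivisors-*-prime {p} {d} p-prime p∤d =
  ∼bag⇒↭ (unique∧set⇒bag (primeDivisors-unique (p * d)) (p∉ ∷ primeDivisors-unique d) (mk⇔ to from))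
  where
  instance _ = ℕ.m*n≢0 p d {{prime⇒nonZero p-prime}}
  p∉ : All (p ≢_) (primeDivisors d)
  p∉ = All.tabulate λ q∈ p≡q → p∤d (subst (_∣ d) (sym p≡q) (proj₂ (∈-primeDivisors⁻ d q∈)))
  to : q ∈ primeDivisors (p * d) → q ∈ p ∷ primeDivisors d
  to q∈ with ∈-primeDivisors⁻ (p * d) q∈
  ... | q-prime , q∣pd with euclidsLemma p d q-prime q∣pd
  ...   | inj₂ q∣d = there (∈-primeDivisors⁺ q-prime q∣d)
  ...   | inj₁ q∣p with prime⇒irreducible p-prime q∣p
  ...     | inj₁ refl = contradiction q-prime ¬prime[1]
  ...     | inj₂ refl = here refl
  from : q ∈ p ∷ primeDivisors d → q ∈ primeDivisors (p * d)
  from (here refl) = ∈-primeDivisors⁺ p-prime (m∣m*n d)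
  from (there q∈)  = let q-prime , q∣d = ∈-primeDivisors⁻ d q∈ in ∈-primeDivisors⁺ q-prime (∣n⇒∣m*n p q∣d)

ω-*-prime : Prime p → p ∤ d → .{{NonZero d}} → ω (p * d) ≡ suc (ω d)
ω-*-prime p-prime p∤d = ↭.↭-length (primeDivisors-*-prime p-prime p∤d)

μ-*-prime : Prime p → p ∤ d → .{{NonZero d}} → μ (p * d) ≡ - μ d
μ-*-prime {p} {d} p-prime p∤d
  rewrite squarefree?-*-prime p-prime p∤d {{it}} | ω-*-prime p-prime p∤d {{it}} with squarefree? d
... | true  = ℤ.-1*i≡-i _
... | false = refl

μ-square : .{{NonZero d}} → 2 ≤ k → k * k ∣ d → μ d ≡ 0ℤ
μ-square {d} 2≤k k²∣d = cong (λ b → if b then (- 1ℤ) ℤ.^ ω d else 0ℤ) (trans (isYes≗does (squares∤? d))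
  (dec-false (squares∤? d) (λ all → Equivalence.to (All-squares∤⇔SquareFree d) all 2≤k k²∣d)))

module Σℤ = CommutativeMonoidFold ℤ.+-0-isCommutativeMonoid
module Πℤ = CommutativeMonoidFold ℤ.*-1-isCommutativeMonoid
open Πℤ using (_when_)

≡-mod-when-cong : ∀ {P : Set} (P? : Dec P) → x ≡ y ⟨mod q ⟩ → x when P? ≡ y when P? ⟨mod q ⟩
≡-mod-when-cong P? x≡y with does P?
... | true  = x≡y
... | false = ≡-mod-refl

≡-mod-*-neg-cancel : x ≡ y ⟨mod q ⟩ → z ℤ.* x ℤ.+ - z ℤ.* y ≡ 0ℤ ⟨mod q ⟩
≡-mod-*-neg-cancel {x} {y} {q} {z} x≡y = ≡-mod-trans
  (≡-mod-+-cong (≡-mod-*-cong (≡-mod-refl {x = z}) x≡y) ≡-mod-refl) (≡-mod-reflexive (identity z y))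
  where
  identity : ∀ z y → z ℤ.* y ℤ.+ - z ℤ.* y ≡ 0ℤ
  identity = solve-∀

prime∤-* : Prime p → p ∤ ∣ x ∣ → p ∤ ∣ y ∣ → p ∤ ∣ x ℤ.* y ∣
prime∤-* {p} {x} {y} p-prime p∤x p∤y p∣xy =
  [ p∤x , p∤y ]′ (euclidsLemma ∣ x ∣ ∣ y ∣ p-prime (subst (p ∣_) (ℤ.abs-* x y) p∣xy))

prime∤-when : ∀ {P : Set} (P? : Dec P) → Prime p → p ∤ ∣ x ∣ → p ∤ ∣ x when P? ∣
prime∤-when P? p-prime p∤x with does P?
... | true  = p∤x
... | false = prime⇒∤1 p-prime

-- a_{n/d}, written exactly as in Defs (where `suc (pred d)` only guards against d = 0).
infix 10 _[_/_]
_[_/_] : (ℕ → ℤ) → ℕ → ℕ → ℤ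
a [ n / d ] = a (n / suc (ℕ.pred d))

[/]-cofactor : ∀ (a : ℕ → ℤ) → .{{NonZero d}} → n ≡ k * d → a [ n / d ] ≡ a k
[/]-cofactor {d} {n} {k} a n≡k*d = cong a (begin
  n / suc (ℕ.pred d) ≡⟨ /-congʳ (ℕ.suc-pred d) ⟩
  n / d              ≡⟨ /-congˡ n≡k*d ⟩
  k * d / d          ≡⟨ m*n/n≡m k d ⟩
  k                  ∎)
  where open ≡.≡-Reasoning

gaussSum : (ℕ → ℤ) → ℕ → ℤ
gaussSum a n = Σℤ.fold (map (λ d → μ d ℤ.* a [ n / d ]) (divisors n))

-x≡y⇔x≡-y : - x ≡ y ⇔ x ≡ - y
-x≡y⇔x≡-y {x} {y} = mk⇔ (λ -x≡y → trans (sym (ℤ.neg-involutive x)) (cong -_ -x≡y))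
                         (λ x≡-y → trans (cong -_ x≡-y) (ℤ.neg-involutive y))

coprime-values⇒prime∤ : ∀ {a : ℕ → ℤ} → (∀ n → 1 ≤ n → gcd ∣ a n ∣ n ≡ 1) →
                        Prime p → ∀ n → .{{NonZero n}} → p ∣ n → p ∤ ∣ a n ∣
coprime-values⇒prime∤ {p = p} coprime p-prime n p∣n p∣an =
  prime⇒∤1 p-prime (subst (p ∣_) (coprime n (ℕ.>-nonZero⁻¹ n)) (gcd-greatest p∣an p∣n))

-- A single prime layer N = p^(j+1) m

LayerCongruence : (ℕ → ℤ) → ℕ → ℕ → ℕ → Set
LayerCongruence a p j c = a (p ^ suc j * c) ≡ a (p ^ j * c) ⟨mod p ^ suc j ⟩

module PrimeLayer {p} (p-prime : Prime p) (j : ℕ) {m} (p∤m : p ∤ m) where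

  instance
    p≢0 : NonZero p
    p≢0 = prime⇒nonZero p-prime
    m≢0 : NonZero m
    m≢0 = ∤⇒nonZero p∤m

  N : ℕ
  N = p ^ suc j * m

  instance
    N≢0 : NonZero N
    N≢0 = ℕ.m*n≢0 (p ^ suc j) m {{ℕ.m^n≢0 p (suc j)}}

  ∈-divisors⇒∤ : d ∈ divisors m → p ∤ d
  ∈-divisors⇒∤ d∈ p∣d = p∤m (∣-trans p∣d (∈-divisors⁻ m d∈))

  divisor-cases : d ∣ N → (p * p ∣ d) ⊎ (d ∣ m) ⊎ (∃[ e ] e ∣ m × d ≡ p * e)
  divisor-cases {d} d∣N with (p * p) ∣? d | p ∣? d
  ... | yes p²∣d | _      = inj₁ p²∣d
  ... | no _     | no p∤d = inj₂ (inj₁ (coprime-divisor (prime∤⇒coprime-^ p-prime p∤d (suc j)) d∣N))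
  ... | no p²∤d  | yes (divides e refl) = inj₂ (inj₂ (e , e∣m , ℕ.*-comm e p))
    where
    p∤e : p ∤ e
    p∤e p∣e = p²∤d (*-monoˡ-∣ p p∣e)
    e∣m : e ∣ m
    e∣m = coprime-divisor (prime∤⇒coprime-^ p-prime p∤e j)
      (*-cancelˡ-∣ p (subst₂ _∣_ (ℕ.*-comm e p) (ℕ.*-assoc p (p ^ j) m) d∣N))

  divisors-↭ : divisors N ↭ divisors m ++ map (p *_) (divisors m) ++ filter ((p * p) ∣?_) (divisors N)
  divisors-↭ = ∼bag⇒↭ (unique∧set⇒bag (divisors-unique N) unique (mk⇔ to from))
    where
    A B R : List ℕ
    A = divisors m
    B = map (p *_) (divisors m)
    R = filter ((p * p) ∣?_) (divisors N)

    ∈R⇒p²∣ : d ∈ R → p * p ∣ d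
    ∈R⇒p²∣ = proj₂ ∘ ∈-filter⁻ ((p * p) ∣?_) {xs = divisors N}

    B∩R=∅ : Disjoint B R
    B∩R=∅ (d∈B , d∈R) with ∈-map⁻ (p *_) d∈B
    ... | e , e∈A , refl = ∈-divisors⇒∤ e∈A (*-cancelˡ-∣ p (∈R⇒p²∣ d∈R))

    A∩BR=∅ : Disjoint A (B ++ R)
    A∩BR=∅ (d∈A , d∈BR) with ∈-++⁻ B d∈BR
    ... | inj₂ d∈R = ∈-divisors⇒∤ d∈A (∣-trans (m∣m*n p) (∈R⇒p²∣ d∈R))
    ... | inj₁ d∈B with ∈-map⁻ (p *_) d∈B
    ...   | e , _ , refl = ∈-divisors⇒∤ d∈A (m∣m*n e)

    unique : Unique (A ++ B ++ R)
    unique = Unique.++⁺ (divisors-unique m)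
      (Unique.++⁺ (Unique.map⁺ (ℕ.*-cancelˡ-≡ _ _ p) (divisors-unique m))
                  (Unique.filter⁺ ((p * p) ∣?_) (divisors-unique N)) B∩R=∅)
      A∩BR=∅

    to : d ∈ divisors N → d ∈ A ++ B ++ R
    to d∈ with divisor-cases (∈-divisors⁻ N d∈)
    ... | inj₁ p²∣d                   = ∈-++⁺ʳ A (∈-++⁺ʳ B (∈-filter⁺ ((p * p) ∣?_) d∈ p²∣d))
    ... | inj₂ (inj₁ d∣m)             = ∈-++⁺ˡ (∈-divisors⁺ d∣m)
    ... | inj₂ (inj₂ (e , e∣m , refl)) = ∈-++⁺ʳ A (∈-++⁺ˡ (∈-map⁺ (p *_) (∈-divisors⁺ e∣m)))

    from : d ∈ A ++ B ++ R → d ∈ divisors N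
    from d∈ with ∈-++⁻ A d∈
    ... | inj₁ d∈A = ∈-divisors⁺ (∣n⇒∣m*n (p ^ suc j) (∈-divisors⁻ m d∈A))
    ... | inj₂ d∈BR with ∈-++⁻ B d∈BR
    ...   | inj₂ d∈R = proj₁ (∈-filter⁻ ((p * p) ∣?_) {xs = divisors N} d∈R)
    ...   | inj₁ d∈B with ∈-map⁻ (p *_) d∈B
    ...     | e , e∈A , refl =
      ∈-divisors⁺ (subst (p * e ∣_) (sym (ℕ.*-assoc p _ m)) (*-monoʳ-∣ p (∣n⇒∣m*n (p ^ j) (∈-divisors⁻ m e∈A))))

  module _ {M : Set} {_∙_ : M → M → M} {ε : M} (isCommutativeMonoid : IsCommutativeMonoid _≡_ _∙_ ε) where

    open CommutativeMonoidFold isCommutativeMonoid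
    open IsCommutativeMonoid isCommutativeMonoid using (identityʳ)

    fold-divisors : (f : ℕ → M) → (∀ {d} → d ∣ N → p * p ∣ d → f d ≡ ε) →
                    fold (map f (divisors N)) ≡ fold (map (λ d → f d ∙ f (p * d)) (divisors m))
    fold-divisors f f[p²∣d]≡ε = begin
      fold (map f (divisors N))
        ≡⟨ fold-↭ (↭.map⁺ f divisors-↭) ⟩
      fold (map f (A ++ B ++ R))
        ≡⟨ cong fold (trans (map-++ f A _) (cong (map f A ++_) (map-++ f B R))) ⟩
      fold (map f A ++ map f B ++ map f R)
        ≡⟨ trans (fold-++ (map f A) _) (cong (fold (map f A) ∙_) (fold-++ (map f B) _)) ⟩
      fold (map f A) ∙ (fold (map f B) ∙ fold (map f R))
        ≡⟨ cong (λ t → fold (map f A) ∙ (fold (map f B) ∙ t)) (fold-map-ε (All.tabulate f≡ε)) ⟩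
      fold (map f A) ∙ (fold (map f B) ∙ ε)
        ≡⟨ cong (fold (map f A) ∙_) (trans (identityʳ _) (cong fold (sym (map-∘ A)))) ⟩
      fold (map f A) ∙ fold (map (f ∘ (p *_)) A)
        ≡⟨ sym (fold-map-∙ f (f ∘ (p *_)) A) ⟩
      fold (map (λ d → f d ∙ f (p * d)) A) ∎
      where
      open ≡.≡-Reasoning
      A B R : List ℕ
      A = divisors m
      B = map (p *_) (divisors m)
      R = filter ((p * p) ∣?_) (divisors N)
      f≡ε : d ∈ R → f d ≡ ε
      f≡ε d∈R = let d∈N , p²∣d = ∈-filter⁻ ((p * p) ∣?_) {xs = divisors N} d∈R
                in f[p²∣d]≡ε (∈-divisors⁻ N d∈N) p²∣d

  μ[p*1]≡-1 : μ (p * 1) ≡ - 1ℤ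
  μ[p*1]≡-1 = μ-*-prime p-prime (prime⇒∤1 p-prime)

  module _ (a : ℕ → ℤ) where

    a[N/d]-cofactor : m ≡ c * d → .{{NonZero d}} → a [ N / d ] ≡ a (p ^ suc j * c)
    a[N/d]-cofactor {c} {d} m≡c*d =
      [/]-cofactor a (trans (cong (p ^ suc j *_) m≡c*d) (sym (ℕ.*-assoc (p ^ suc j) c d)))

    a[N/pd]-cofactor : m ≡ c * d → .{{NonZero d}} → a [ N / p * d ] ≡ a (p ^ j * c)
    a[N/pd]-cofactor {c} {d} m≡c*d =
      [/]-cofactor a {{ℕ.m*n≢0 p d}} (trans (cong (p ^ suc j *_) m≡c*d) (identity p (p ^ j) c d))
      where
      identity : ∀ p P c d → p * P * (c * d) ≡ P * c * (p * d)
      identity = ℕ-solve-∀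

    gaussSum-layer : (∀ {c} → c ∣ m → LayerCongruence a p j c) →
                     gaussSum a N ≡ 0ℤ ⟨mod p ^ suc j ⟩
    gaussSum-layer layer-congruence = begin
      gaussSum a N
        ≡⟨ fold-divisors ℤ.+-0-isCommutativeMonoid term term≡0 ⟩
      Σℤ.fold (map (λ d → term d ℤ.+ term (p * d)) (divisors m))
        ≈⟨ Σℤ.fold-map-closed (_≡ 0ℤ ⟨mod p ^ suc j ⟩) ≡-mod-refl ≡-mod-+-cong (All.tabulate pair≡0) ⟩
      0ℤ ∎
      where
      open ≈-Reasoning (≡-mod-setoid (p ^ suc j))
      term : ℕ → ℤ
      term d = μ d ℤ.* a [ N / d ]
      term≡0 : d ∣ N → p * p ∣ d → term d ≡ 0ℤ
      term≡0 {d} d∣N p²∣d = cong (ℤ._* a [ N / d ]) (μ-square {{∣⇒nonZero d∣N}} (prime⇒2≤ p-prime) p²∣d)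
      pair≡0 : d ∈ divisors m → term d ℤ.+ term (p * d) ≡ 0ℤ ⟨mod p ^ suc j ⟩
      pair≡0 {d} d∈ with ∈-divisors⁻ m d∈
      ... | d∣m@(divides c m≡c*d) = begin
        μ d ℤ.* a [ N / d ] ℤ.+ μ (p * d) ℤ.* a [ N / p * d ]
          ≡⟨ cong₂ ℤ._+_ (cong (μ d ℤ.*_) (a[N/d]-cofactor m≡c*d))
                         (cong₂ ℤ._*_ (μ-*-prime p-prime (∈-divisors⇒∤ d∈)) (a[N/pd]-cofactor m≡c*d)) ⟩
        μ d ℤ.* a (p ^ suc j * c) ℤ.+ - μ d ℤ.* a (p ^ j * c)
          ≈⟨ ≡-mod-*-neg-cancel {z = μ d} (layer-congruence (quotient-∣ d∣m)) ⟩
        0ℤ ∎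
        where instance _ = ∣⇒nonZero d∣m

    factor : ℤ → ℕ → ℤ
    factor s d = a [ N / d ] when (μ d ℤ.≟ s)

    pair : ℤ → ℕ → ℤ
    pair s d = factor s d ℤ.* factor s (p * d)

    -- What `pair s d` becomes (for d > 1) once a_{N/(pd)} is replaced by the congruent a_{N/d};
    -- unlike `pair`, it is symmetric under s ↦ -s.
    symmetricPair : ℤ → ℕ → ℤ
    symmetricPair s d = a [ N / d ] when (μ d ℤ.≟ s) ℤ.* a [ N / d ] when (μ d ℤ.≟ - s)

    symmetricPairs : ℤ → ℤ
    symmetricPairs s = Πℤ.fold (map (symmetricPair s) (divisors>1 m))

    prodμ≡pairs : s ≢ 0ℤ → prodμ a s N ≡ pair s 1 ℤ.* Πℤ.fold (map (pair s) (divisors>1 m))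
    prodμ≡pairs {s} s≢0 = begin
      prodμ a s N                                    ≡⟨ Πℤ.fold-filter (λ d → μ d ℤ.≟ s) (λ d → a [ N / d ]) (divisors N) ⟩
      Πℤ.fold (map (factor s) (divisors N))          ≡⟨ fold-divisors ℤ.*-1-isCommutativeMonoid (factor s) factor≡1 ⟩
      Πℤ.fold (map (pair s) (divisors m))            ≡⟨ cong (Πℤ.fold ∘ map (pair s)) (divisors≡1∷divisors>1 m) ⟩
      pair s 1 ℤ.* Πℤ.fold (map (pair s) (divisors>1 m)) ∎
      where
      open ≡.≡-Reasoning
      factor≡1 : d ∣ N → p * p ∣ d → factor s d ≡ 1ℤ
      factor≡1 {d} d∣N p²∣d = Πℤ.when-false (μ d ℤ.≟ s)
        (λ μd≡s → s≢0 (trans (sym μd≡s) (μ-square {{∣⇒nonZero d∣N}} (prime⇒2≤ p-prime) p²∣d)))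

    pair[1,1]≡a[N] : pair 1ℤ 1 ≡ a N
    pair[1,1]≡a[N] = begin
      a [ N / 1 ] ℤ.* a [ N / p * 1 ] when (μ (p * 1) ℤ.≟ 1ℤ)
        ≡⟨ cong₂ ℤ._*_ (cong a (n/1≡n N)) (Πℤ.when-false (μ (p * 1) ℤ.≟ 1ℤ) μ[p*1]≢1) ⟩
      a N ℤ.* 1ℤ
        ≡⟨ ℤ.*-identityʳ (a N) ⟩
      a N ∎
      where
      open ≡.≡-Reasoning
      μ[p*1]≢1 : μ (p * 1) ≢ 1ℤ
      μ[p*1]≢1 μ[p*1]≡1 = case trans (sym μ[p*1]≡-1) μ[p*1]≡1 of λ ()

    pair[-1,1]≡a[p^j*m] : pair (- 1ℤ) 1 ≡ a (p ^ j * m)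
    pair[-1,1]≡a[p^j*m] = begin
      1ℤ ℤ.* a [ N / p * 1 ] when (μ (p * 1) ℤ.≟ - 1ℤ)
        ≡⟨ ℤ.*-identityˡ _ ⟩
      a [ N / p * 1 ] when (μ (p * 1) ℤ.≟ - 1ℤ)
        ≡⟨ Πℤ.when-true (μ (p * 1) ℤ.≟ - 1ℤ) μ[p*1]≡-1 ⟩
      a [ N / p * 1 ]
        ≡⟨ a[N/pd]-cofactor (sym (ℕ.*-identityʳ m)) ⟩
      a (p ^ j * m) ∎
      where open ≡.≡-Reasoning

    symmetricPairs[-1]≡symmetricPairs[1] : symmetricPairs (- 1ℤ) ≡ symmetricPairs 1ℤ
    symmetricPairs[-1]≡symmetricPairs[1] = cong Πℤ.fold (map-cong comm (divisors>1 m))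
      where
      comm : ∀ d → symmetricPair (- 1ℤ) d ≡ symmetricPair 1ℤ d
      comm d = ℤ.*-comm (a [ N / d ] when (μ d ℤ.≟ - 1ℤ)) (a [ N / d ] when (μ d ℤ.≟ 1ℤ))

    prime∤symmetricPairs : (∀ n → 1 ≤ n → gcd ∣ a n ∣ n ≡ 1) → p ∤ ∣ symmetricPairs s ∣
    prime∤symmetricPairs {s} coprime =
      Πℤ.fold-map-closed (λ x → p ∤ ∣ x ∣) (prime⇒∤1 p-prime) (λ {x} {y} → prime∤-* {x = x} {y = y} p-prime)
        (All.tabulate prime∤symmetricPair)
      where
      prime∤a[N/d] : d ∈ divisors>1 m → p ∤ ∣ a [ N / d ] ∣
      prime∤a[N/d] d∈ with ∈-divisors>1⁻ m d∈
      ... | d∣m@(divides c m≡c*d) , _ =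
        subst (λ t → p ∤ ∣ t ∣) (sym (a[N/d]-cofactor m≡c*d {{∣⇒nonZero d∣m}}))
          (coprime-values⇒prime∤ {a = a} coprime p-prime (p ^ suc j * c) {{qc≢0}} (∣-trans (m∣m*n (p ^ j)) (m∣m*n c)))
        where
        qc≢0 : NonZero (p ^ suc j * c)
        qc≢0 = ℕ.m*n≢0 (p ^ suc j) c {{ℕ.m^n≢0 p (suc j)}} {{quotient≢0 d∣m}}
      prime∤symmetricPair : d ∈ divisors>1 m → p ∤ ∣ symmetricPair s d ∣
      prime∤symmetricPair {d} d∈ =
        prime∤-* {x = a [ N / d ] when (μ d ℤ.≟ s)} {y = a [ N / d ] when (μ d ℤ.≟ - s)} p-prime
          (prime∤-when (μ d ℤ.≟ s) p-prime (prime∤a[N/d] d∈)) (prime∤-when (μ d ℤ.≟ - s) p-prime (prime∤a[N/d] d∈))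

    module _ (ih : ∀ {c} → c ∣ m → c < m → LayerCongruence a p j c) where

      pair≡symmetricPair : d ∈ divisors>1 m → pair s d ≡ symmetricPair s d ⟨mod p ^ suc j ⟩
      pair≡symmetricPair {d} {s} d∈ with ∈-divisors>1⁻ m d∈
      ... | d∣m@(divides c m≡c*d) , 2≤d = ≡-mod-*-cong (≡-mod-refl {x = factor s d}) (begin
        a [ N / p * d ] when (μ (p * d) ℤ.≟ s) ≡⟨ Πℤ.when-⇔ μ[pd]≡s⇔μd≡-s (μ (p * d) ℤ.≟ s) (μ d ℤ.≟ - s) ⟩
        a [ N / p * d ] when (μ d ℤ.≟ - s)     ≈⟨ ≡-mod-when-cong (μ d ℤ.≟ - s) a[N/pd]≡a[N/d] ⟩
        a [ N / d ] when (μ d ℤ.≟ - s)         ∎)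
        where
        open ≈-Reasoning (≡-mod-setoid (p ^ suc j))
        instance
          _ = ∣⇒nonZero d∣m
          _ = quotient≢0 d∣m
        μ[pd]≡s⇔μd≡-s : μ (p * d) ≡ s ⇔ μ d ≡ - s
        μ[pd]≡s⇔μd≡-s = ⇔.trans (mk⇔ (trans (sym μ[pd]≡-μd)) (trans μ[pd]≡-μd)) -x≡y⇔x≡-y
          where μ[pd]≡-μd = μ-*-prime p-prime (p∤m ∘ λ p∣d → ∣-trans p∣d d∣m)
        a[N/pd]≡a[N/d] : a [ N / p * d ] ≡ a [ N / d ] ⟨mod p ^ suc j ⟩
        a[N/pd]≡a[N/d] = subst₂ _≡_⟨mod p ^ suc j ⟩ (sym (a[N/pd]-cofactor m≡c*d)) (sym (a[N/d]-cofactor m≡c*d))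
          (≡-mod-sym (ih (quotient-∣ d∣m) (subst (c <_) (sym m≡c*d) (ℕ.m<m*n c d 2≤d))))

      prodμ≡symmetricPairs : s ≢ 0ℤ → prodμ a s N ≡ pair s 1 ℤ.* symmetricPairs s ⟨mod p ^ suc j ⟩
      prodμ≡symmetricPairs {s} s≢0 = begin
        prodμ a s N
          ≡⟨ prodμ≡pairs s≢0 ⟩
        pair s 1 ℤ.* Πℤ.fold (map (pair s) (divisors>1 m))
          ≈⟨ ≡-mod-*-cong (≡-mod-refl {x = pair s 1}) (Πℤ.fold-map-cong _≡_⟨mod p ^ suc j ⟩ ≡-mod-refl ≡-mod-*-cong
               (All.tabulate (pair≡symmetricPair {s = s}))) ⟩
        pair s 1 ℤ.* symmetricPairs s ∎
        where open ≈-Reasoning (≡-mod-setoid (p ^ suc j))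

      eulerGauss-layer : EulerGauss a → (∀ n → 1 ≤ n → gcd ∣ a n ∣ n ≡ 1) → LayerCongruence a p j m
      eulerGauss-layer eulerGauss coprime = ≡-mod-*-cancelʳ {k = suc j} p-prime (prime∤symmetricPairs coprime) (begin
        a N ℤ.* Y                          ≡⟨ cong (ℤ._* Y) pair[1,1]≡a[N] ⟨
        pair 1ℤ 1 ℤ.* Y                    ≈⟨ prodμ≡symmetricPairs (λ ()) ⟨
        prodμ a 1ℤ N                       ≈⟨ ≡-mod-∣ (m∣m*n m) (≡[mod]⇒≡⟨mod⟩ (eulerGauss N (ℕ.>-nonZero⁻¹ N))) ⟩
        prodμ a (- 1ℤ) N                   ≈⟨ prodμ≡symmetricPairs (λ ()) ⟩
        pair (- 1ℤ) 1 ℤ.* symmetricPairs (- 1ℤ) ≡⟨ cong₂ ℤ._*_ pair[-1,1]≡a[p^j*m] symmetricPairs[-1]≡symmetricPairs[1] ⟩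
        a (p ^ j * m) ℤ.* Y                ∎)
        where
        open ≈-Reasoning (≡-mod-setoid (p ^ suc j))
        Y = symmetricPairs 1ℤ

module _ (a : ℕ → ℤ) (eulerGauss : EulerGauss a) (coprime : ∀ n → 1 ≤ n → gcd ∣ a n ∣ n ≡ 1) where

  eulerGauss⇒layer-congruence : Prime p → ∀ j m → p ∤ m → LayerCongruence a p j m
  eulerGauss⇒layer-congruence {p} p-prime j = <-rec _ layer-congruence
    where
    layer-congruence : ∀ m → (∀ {c} → c < m → p ∤ c → LayerCongruence a p j c) → p ∤ m → LayerCongruence a p j m
    layer-congruence m rec p∤m = PrimeLayer.eulerGauss-layer p-prime j p∤m a
      (λ c∣m c<m → rec c<m (λ p∣c → p∤m (∣-trans p∣c c∣m))) eulerGauss coprime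

  gaussSum≡0-mod-p-part : Prime p → p ∤ m → ∀ k → gaussSum a (p ^ k * m) ≡ 0ℤ [mod p ^ k ]
  gaussSum≡0-mod-p-part p-prime p∤m zero    = 1∣ _
  gaussSum≡0-mod-p-part p-prime p∤m (suc j) = ≡⟨mod⟩⇒≡[mod]
    (PrimeLayer.gaussSum-layer p-prime j p∤m a (λ {c} c∣m →
      eulerGauss⇒layer-congruence p-prime j c (λ p∣c → p∤m (∣-trans p∣c c∣m))))

theorem3 : (a : ℕ → ℤ) → EulerGauss a →
    (∀ n → 1 ≤ n → gcd ∣ a n ∣ n ≡ 1) → Gauss a
theorem3 a eulerGauss coprime n 1≤n = prime-powers-∣⇒∣ n {{>-nonZero 1≤n}} gaussSum≡0-mod-prime-power
  where
  gaussSum≡0-mod-prime-power : ∀ p k → Prime p → p ^ k ∣ n → gaussSum a n ≡ 0ℤ [mod p ^ k ]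
  gaussSum≡0-mod-prime-power p k p-prime p^k∣n with p-adic-split p-prime n {{>-nonZero 1≤n}}
  ... | K , m , p∤m , n≡p^K*m = ∣-trans
    (prime^∣*∤⇒∣ p-prime p∤m k (subst (p ^ k ∣_) n≡p^K*m p^k∣n))
    (subst (λ n → gaussSum a n ≡ 0ℤ [mod p ^ K ]) (sym n≡p^K*m)
      (gaussSum≡0-mod-p-part a eulerGauss coprime p-prime p∤m K))
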